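{- Let $\phi$ be a discrete-time STL formula in strict normal form. Then the complete tableau (with the JUMP rule) for $\phi$ is a finite tree.
   Context: Discrete-time STL. Fix a finite set $S=\{x_1,\dots,x_n\}$ of real-valued signal variables; a signal is a function $w:\mathbb{N}\to\mathbb{R}^n$, and $w_R$ denotes its projection on $R\subseteq S$. Atomic constraints are $f(R)=k$ and $f(R)>k$ with $R\subseteq S$, $f:\mathbb{R}^{|R|}\to\mathbb{R}$ linear, $k\in\mathbb{Q}$. Terms are $\top$, atomic constraints, and their negations. The strict until and strict release operators, for $a\le b$ in $\mathbb{N}$, have semantics: $(w,t)\models \psi_1\,\mathsf{sU}_{[a,b]}\,\psi_2$ iff there is $t'\in[t+a,t+b]$ with $(w,t')\models\psi_2$ and $(w,t'')\models\psi_1$ for all $t''\in[t+a,t'-1]$; $(w,t)\models \psi_1\,\mathsf{sR}_{[a,b]}\,\psi_2$ iff for all $t'\in[t+a,t+b]$, $(w,t')\models\psi_2$ or there is $t''\in[t+a,t'-1]$ with $(w,t'')\models\psi_1$. A formula is in strict normal form if it is built from terms using only $\wedge,\vee,\mathsf{sU},\mathsf{sR}$. For a temporal operator $\psi$ with interval $[a,b]$ write $I_\ell(\psi)=a$, $I_u(\psi)=b$. The propositional closure is $\mathrm{pcl}(\neg\psi_1)=\{\psi_1\}$, $\mathrm{pcl}(\psi_1\wedge\psi_2)=\mathrm{pcl}(\psi_1\vee\psi_2)=\{\psi_1,\psi_2\}$, $\mathrm{pcl}(\psi)=\{\psi\}$ for a temporal operator $\psi$. Tableau. In node labels, a temporal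 operator occurrence $\psi_1\,\mathsf{B}_I\,\psi_2$ ($\mathsf{B}\in\{\mathsf{sU},\mathsf{sR}\}$) carries a superscript interval $J$ (written $\psi_1\,\mathsf{B}^J_I\,\psi_2$) and may be marked (written $\overline{\mathsf{B}}$). For an interval $I$ and $t\in\mathbb{N}$, the temporal expansion $\exp^t_I$ is the identity on terms, commutes with $\neg,\wedge,\vee$, and maps $\psi_1\,\mathsf{B}_{[a,b]}\,\psi_2$ to $\psi_1\,\mathsf{B}^I_{[a+t,b+t]}\,\psi_2$ (arguments unchanged). Each node $u$ has a finite set of formulas $\Gamma(u)$ and a time $t(u)\in\mathbb{N}$. The root has $t=0$ and label $\{\phi\}$, where the temporal operators of $\phi$ not nested in other temporal operators get superscript $[-1,-1]$. Rules: (Expansion) If $\Gamma(u)$ contains a formula $\psi$ of one of the following forms, pick such a $\psi$ and create children $u_1$ (and $u_2$) with the same time and $\Gamma(u_i)=(\Gamma(u)\setminus\{\psi\})\cup\Gamma_i$: for $\psi=\psi_1\vee\psi_2$: $\Gamma_1=\{\psi_1\}$, $\Gamma_2=\{\psi_2\}$; for $\psi=\psi_1\wedge\psi_2$: a single child with $\Gamma_1=\{\psi_1,\psi_2\}$; for unmarked $\psi=\psi_1\,\mathsf{sU}^J_I\,\psi_2$ with $t(u)\in I$: $\Gamma_1=\{\exp^{t(u)}_I(\psi_2)\}$, $\Gamma_2=\{\exp^{t(u)}_I(\psi_1),\ \psi_1\,\overline{\mathsf{sU}}^J_I\,\psi_2\}$; for unmarked $\psi=\psi_1\,\mathsf{sR}^J_I\,\psi_2$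 with $t(u)\in I$: $\Gamma_1=\{\exp^{t(u)}_I(\psi_1\wedge\psi_2)\}$, $\Gamma_2=\{\exp^{t(u)}_I(\psi_2),\ \psi_1\,\overline{\mathsf{sR}}^J_I\,\psi_2\}$. A node to which no expansion rule applies is poised. A poised $u$ is rejected if $\neg\top\in\Gamma(u)$; or if the set of atomic constraints and negated atomic constraints in $\Gamma(u)$ is unsatisfiable over the reals; or if $\Gamma(u)$ contains a marked $\psi_1\,\overline{\mathsf{sU}}^J_{[a,b]}\,\psi_2$ with $b=t(u)$. Otherwise it is accepted if $\Gamma(u)$ contains no temporal operators. Accepted and rejected nodes are leaves. Any other poised node gets one child $u'$ by STEP or JUMP: STEP applies iff $\Gamma(u)$ contains a marked $\psi_1\,\overline{\mathsf{sU}}^J_{[a,b]}\,\psi_2$ (resp. $\psi_2\,\overline{\mathsf{sR}}^J_{[a,b]}\,\psi_1$) with $t(u)\notin J$ such that $t(u)=b$ or some temporal operator $\chi\in\mathrm{pcl}(\psi_1)$ satisfies $t(u)<a+I_u(\chi)$. Then $t(u')=t(u)+1$ and $\Gamma(u')$ consists of the unmarked temporal operators of $\Gamma(u)$ and the unmarked copies (same superscript and interval) of the marked operators $\psi_1\,\overline{\mathsf{B}}^J_{[a,b]}\,\psi_2\in\Gamma(u)$ with $t(u)<b$. JUMP applies otherwise. Let $K(u)$ be the set of all $a,b$ such that some (marked or unmarked) $\psi_1\,\mathsf{B}^J_{[a,b]}\,\psi_2\in\Gamma(u)$ has $t(u)\notin J$. Then $t(u')=\min\{t\in K(u)\mid t>t(u)\}$,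 $k=t(u')-t(u)$, and $\Gamma(u')$ is the union of: unmarked $\psi_1\,\mathsf{B}^J_I\,\psi_2\in\Gamma(u)$ with $t(u)\notin J$ (unchanged); $\psi_1\,\mathsf{B}^J_{[a+k,b+k]}\,\psi_2$ for each unmarked $\psi_1\,\mathsf{B}^J_{[a,b]}\,\psi_2\in\Gamma(u)$ with $t(u)\in J$; the unmarked $\psi_1\,\mathsf{B}^J_{[a,b]}\,\psi_2$ for each marked $\psi_1\,\overline{\mathsf{B}}^J_{[a,b]}\,\psi_2\in\Gamma(u)$ with $t(u)\notin J$ and $t(u)<b$; and the unmarked $\psi_1\,\mathsf{B}^J_{[a+k,b+k]}\,\psi_2$ for each marked $\psi_1\,\overline{\mathsf{B}}^J_{[a,b]}\,\psi_2\in\Gamma(u)$ with $t(u)\in J$ and $t(u)<b$. The complete tableau is obtained by applying these rules until no rule applies to any leaf. -}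

module Defs where

open import Data.Nat using (ℕ; zero; suc; _+_; _∸_; _≤_; _<_)
open import Data.Integer as ℤ using (ℤ; +_; -[1+_])
open import Data.Bool using (Bool; true; false)
open import Data.List using (List; []; _∷_)
open import Data.List.Membership.Propositional using (_∈_)
open import Data.Product using (Σ; _×_; _,_; ∃; ∃-syntax)
open import Data.Sum using (_⊎_)
open import Relation.Nullary using (¬_)
open import Relation.Binary.PropositionalEquality using (_≡_; _≢_)
open import Function.Bundles using (_⇔_)
open import Induction.WellFounded using (Acc)

-- Syntax.  Atomic constraints (f(R)=k, f(R)>k with f linear over ℝ) are
-- kept abstract: an arbitrary type Atom.  Their (un)satisfiability over
-- the reals is an arbitrary predicate Unsat.

data Lit (Atom : Set) : Set where
  pos : Atom → Lit Atom
  neg : Atom → Lit Atom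

data Term (Atom : Set) : Set where
  tt  : Term Atom
  ff  : Term Atom
  lit : Lit Atom → Term Atom

data Op : Set where
  sU sR : Op

-- formulas in strict normal form: built from terms with ∧, ∨, sU, sR
-- tmp B a b ψ₁ ψ₂  is  ψ₁ B_[a,b] ψ₂
data Fml (Atom : Set) : Set where
  term : Term Atom → Fml Atom
  _∧_  : Fml Atom → Fml Atom → Fml Atom
  _∨_  : Fml Atom → Fml Atom → Fml Atom
  tmp  : Op → ℕ → ℕ → Fml Atom → Fml Atom → Fml Atom

data WF {Atom : Set} : Fml Atom → Set where
  wf-term : ∀ {x} → WF (term x)
  wf-∧    : ∀ {φ ψ} → WF φ → WF ψ → WF (φ ∧ ψ)
  wf-∨    : ∀ {φ ψ} → WF φ → WF ψ → WF (φ ∨ ψ)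
  wf-tmp  : ∀ {B a b φ ψ} → a ≤ b → WF φ → WF ψ → WF (tmp B a b φ ψ)

-- propositional closure (literally as defined in the paper)
pcl : {Atom : Set} → Fml Atom → List (Fml Atom)
pcl (term (lit (neg x))) = term (lit (pos x)) ∷ []
pcl (term ff)            = term tt ∷ []
pcl (term x)             = term x ∷ []
pcl (φ ∧ ψ)              = φ ∷ ψ ∷ []
pcl (φ ∨ ψ)              = φ ∷ ψ ∷ []
pcl (tmp B a b φ ψ)      = tmp B a b φ ψ ∷ []

-- Superscript intervals J (integer bounds, to allow [-1,-1])

SInt : Set
SInt = ℤ × ℤ

_∈ᴶ_ : ℕ → SInt → Set
t ∈ᴶ (l , u) = (l ℤ.≤ + t) × (+ t ℤ.≤ u)

ι : ℕ → ℕ → SInt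
ι a b = (+ a , + b)

minus1 : SInt
minus1 = (-[1+ 0 ] , -[1+ 0 ])

-- formulas in node labels: temporal operators carry a mark flag
-- (true = marked), a superscript J and a (shifted) interval [a,b];
-- their arguments are plain formulas.
data LFml (Atom : Set) : Set where
  term : Term Atom → LFml Atom
  _∧_  : LFml Atom → LFml Atom → LFml Atom
  _∨_  : LFml Atom → LFml Atom → LFml Atom
  tmp  : (marked : Bool) → Op → (J : SInt) → (a b : ℕ) →
         Fml Atom → Fml Atom → LFml Atom

expn : {Atom : Set} → SInt → ℕ → Fml Atom → LFml Atom
expn I t (term x)        = term x
expn I t (φ ∧ ψ)         = expn I t φ ∧ expn I t ψ
expn I t (φ ∨ ψ)         = expn I t φ ∨ expn I t ψ
expn I t (tmp B a b φ ψ) = tmp false B I (t + a) (t + b) φ ψ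

-- Tableau nodes: a finite set of formulas (represented by a list, only
-- its membership matters) and a time.

Node : Set → Set
Node Atom = List (LFml Atom) × ℕ

root : {Atom : Set} → Fml Atom → Node Atom
root φ = (expn minus1 0 φ ∷ [] , 0)

module _ {Atom : Set} where

  Replace : List (LFml Atom) → LFml Atom → List (LFml Atom) →
            List (LFml Atom) → Set
  Replace Γ ψ Δ Γ' = ∀ x → (x ∈ Γ') ⇔ (((x ∈ Γ) × (x ≢ ψ)) ⊎ (x ∈ Δ))

  data Expandable (t : ℕ) : LFml Atom → Set where
    ex-∨ : ∀ {φ ψ} → Expandable t (φ ∨ ψ)
    ex-∧ : ∀ {φ ψ} → Expandable t (φ ∧ ψ)
    ex-tmp : ∀ {B J a b φ ψ} → a ≤ t → t ≤ b →
             Expandable t (tmp false B J a b φ ψ)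

  data ExpandChild (Γ : List (LFml Atom)) (t : ℕ) :
       List (LFml Atom) → Set where
    ∨₁ : ∀ {φ ψ Γ'} → (φ ∨ ψ) ∈ Γ →
         Replace Γ (φ ∨ ψ) (φ ∷ []) Γ' → ExpandChild Γ t Γ'
    ∨₂ : ∀ {φ ψ Γ'} → (φ ∨ ψ) ∈ Γ →
         Replace Γ (φ ∨ ψ) (ψ ∷ []) Γ' → ExpandChild Γ t Γ'
    ∧₁ : ∀ {φ ψ Γ'} → (φ ∧ ψ) ∈ Γ →
         Replace Γ (φ ∧ ψ) (φ ∷ ψ ∷ []) Γ' → ExpandChild Γ t Γ'
    sU₁ : ∀ {J a b ψ₁ ψ₂ Γ'} → tmp false sU J a b ψ₁ ψ₂ ∈ Γ →
          a ≤ t → t ≤ b →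
          Replace Γ (tmp false sU J a b ψ₁ ψ₂)
                  (expn (ι a b) t ψ₂ ∷ []) Γ' →
          ExpandChild Γ t Γ'
    sU₂ : ∀ {J a b ψ₁ ψ₂ Γ'} → tmp false sU J a b ψ₁ ψ₂ ∈ Γ →
          a ≤ t → t ≤ b →
          Replace Γ (tmp false sU J a b ψ₁ ψ₂)
                  (expn (ι a b) t ψ₁ ∷ tmp true sU J a b ψ₁ ψ₂ ∷ []) Γ' →
          ExpandChild Γ t Γ'
    sR₁ : ∀ {J a b ψ₁ ψ₂ Γ'} → tmp false sR J a b ψ₁ ψ₂ ∈ Γ →
          a ≤ t → t ≤ b →
          Replace Γ (tmp false sR J a b ψ₁ ψ₂)
                  (expn (ι a b) t (ψ₁ ∧ ψ₂) ∷ []) Γ' →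
          ExpandChild Γ t Γ'
    sR₂ : ∀ {J a b ψ₁ ψ₂ Γ'} → tmp false sR J a b ψ₁ ψ₂ ∈ Γ →
          a ≤ t → t ≤ b →
          Replace Γ (tmp false sR J a b ψ₁ ψ₂)
                  (expn (ι a b) t ψ₂ ∷ tmp true sR J a b ψ₁ ψ₂ ∷ []) Γ' →
          ExpandChild Γ t Γ'

  Poised : List (LFml Atom) → ℕ → Set
  Poised Γ t = ∀ ψ → ψ ∈ Γ → ¬ Expandable t ψ

  Rejected : ((Lit Atom → Set) → Set) → List (LFml Atom) → ℕ → Set
  Rejected Unsat Γ t =
      (term ff ∈ Γ)
    ⊎ Unsat (λ l → term (lit l) ∈ Γ)
    ⊎ (∃[ J ] ∃[ a ] ∃[ b ] ∃[ ψ₁ ] ∃[ ψ₂ ]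
         (tmp true sU J a b ψ₁ ψ₂ ∈ Γ) × (b ≡ t))

  IsTemporal : LFml Atom → Set
  IsTemporal ψ = ∃[ m ] ∃[ B ] ∃[ J ] ∃[ a ] ∃[ b ] ∃[ ψ₁ ] ∃[ ψ₂ ]
                   (ψ ≡ tmp m B J a b ψ₁ ψ₂)

  NoTemporal : List (LFml Atom) → Set
  NoTemporal Γ = ∀ ψ → ψ ∈ Γ → ¬ IsTemporal ψ

  -- the argument whose propositional closure is inspected by STEP:
  -- ψ₁ in ψ₁ sU ψ₂, and ψ₂ in ψ₁ sR ψ₂ (the paper writes ψ₂ sR ψ₁)
  stepArg : Op → Fml Atom → Fml Atom → Fml Atom
  stepArg sU ψ₁ ψ₂ = ψ₁
  stepArg sR ψ₁ ψ₂ = ψ₂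

  data StepCond (Γ : List (LFml Atom)) (t : ℕ) : Set where
    atEnd : ∀ {B J a b ψ₁ ψ₂} → tmp true B J a b ψ₁ ψ₂ ∈ Γ →
            ¬ (t ∈ᴶ J) → t ≡ b → StepCond Γ t
    inner : ∀ {B J a b ψ₁ ψ₂ B' a' b' χ₁ χ₂} →
            tmp true B J a b ψ₁ ψ₂ ∈ Γ → ¬ (t ∈ᴶ J) →
            tmp B' a' b' χ₁ χ₂ ∈ pcl (stepArg B ψ₁ ψ₂) →
            t < a + b' → StepCond Γ t

  data StepMem (Γ : List (LFml Atom)) (t : ℕ) : LFml Atom → Set where
    keep   : ∀ {B J a b ψ₁ ψ₂} → tmp false B J a b ψ₁ ψ₂ ∈ Γ →
             StepMem Γ t (tmp false B J a b ψ₁ ψ₂)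
    unmark : ∀ {B J a b ψ₁ ψ₂} → tmp true B J a b ψ₁ ψ₂ ∈ Γ → t < b →
             StepMem Γ t (tmp false B J a b ψ₁ ψ₂)

  data InK (Γ : List (LFml Atom)) (t : ℕ) (s : ℕ) : Set where
    lower : ∀ {m B J a b ψ₁ ψ₂} → tmp m B J a b ψ₁ ψ₂ ∈ Γ →
            ¬ (t ∈ᴶ J) → s ≡ a → InK Γ t s
    upper : ∀ {m B J a b ψ₁ ψ₂} → tmp m B J a b ψ₁ ψ₂ ∈ Γ →
            ¬ (t ∈ᴶ J) → s ≡ b → InK Γ t s

  IsNextJump : List (LFml Atom) → ℕ → ℕ → Set
  IsNextJump Γ t t' = InK Γ t t' × t < t' ×
                      (∀ s → InK Γ t s → t < s → t' ≤ s)

  data JumpMem (Γ : List (LFml Atom)) (t k : ℕ) : LFml Atom → Set where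
    keep    : ∀ {B J a b ψ₁ ψ₂} → tmp false B J a b ψ₁ ψ₂ ∈ Γ →
              ¬ (t ∈ᴶ J) → JumpMem Γ t k (tmp false B J a b ψ₁ ψ₂)
    shift   : ∀ {B J a b ψ₁ ψ₂} → tmp false B J a b ψ₁ ψ₂ ∈ Γ →
              t ∈ᴶ J → JumpMem Γ t k (tmp false B J (a + k) (b + k) ψ₁ ψ₂)
    unmark  : ∀ {B J a b ψ₁ ψ₂} → tmp true B J a b ψ₁ ψ₂ ∈ Γ →
              ¬ (t ∈ᴶ J) → t < b → JumpMem Γ t k (tmp false B J a b ψ₁ ψ₂)
    unmarkShift : ∀ {B J a b ψ₁ ψ₂} → tmp true B J a b ψ₁ ψ₂ ∈ Γ →
              t ∈ᴶ J → t < b →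
              JumpMem Γ t k (tmp false B J (a + k) (b + k) ψ₁ ψ₂)

  -- u ⟶ v : v is a possible child of u in a complete tableau
  -- (the choice of the expanded formula ψ is arbitrary)
  data Child (Unsat : (Lit Atom → Set) → Set) : Node Atom → Node Atom → Set where
    expand : ∀ {Γ Γ' t} → ExpandChild Γ t Γ' → Child Unsat (Γ , t) (Γ' , t)
    step   : ∀ {Γ Γ' t} → Poised Γ t → ¬ Rejected Unsat Γ t →
             ¬ NoTemporal Γ → StepCond Γ t →
             (∀ x → (x ∈ Γ') ⇔ StepMem Γ t x) →
             Child Unsat (Γ , t) (Γ' , suc t)
    jump   : ∀ {Γ Γ' t t'} → Poised Γ t → ¬ Rejected Unsat Γ t →
             ¬ NoTemporal Γ → ¬ StepCond Γ t → IsNextJump Γ t t' →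
             (∀ x → (x ∈ Γ') ⇔ JumpMem Γ t (t' ∸ t) x) →
             Child Unsat (Γ , t) (Γ' , t')

  -- the (finitely branching) complete tableau rooted at u, for every
  -- choice of expanded formulas, is finite: every branch is finite,
  -- i.e. u is accessible for the child relation.
  FiniteTableau : ((Lit Atom → Set) → Set) → Node Atom → Set
  FiniteTableau Unsat u = Acc (λ v w → Child Unsat w v) u

-- Expansion rules replace one formula of a label by finitely many strictly
-- smaller ones (marking an operator makes it smaller), so between two STEP/JUMP
-- moves a branch is finite by well-foundedness of this replacement order on
-- finite sets.  STEP and JUMP strictly increase the time, and the time stays
-- bounded: with G the largest interval endpoint in φ, every interval in a label
-- lies below the current time + G and at most 2G above the upper end of its
-- superscript, while a superscript grows by at most 2G per level of temporal
-- nesting.  Hence the pair (bound − time, label) decreases lexicographically.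
module Submission where

open import Defs
open import Data.Nat using (ℕ; suc; _+_; _*_; _∸_; _≤_; _<_; _⊔_; z≤n; s≤s)
open import Data.Nat.Properties
open import Algebra.Properties.CommutativeSemigroup +-commutativeSemigroup using (xy∙z≈xz∙y)
open import Data.Nat.Induction using (<-wellFounded)
open import Data.Integer as ℤ using (+_)
open import Data.Bool using (true; false)
open import Data.List using (List; []; _∷_; _++_)
open import Data.List.Membership.Propositional using (_∈_)
open import Data.List.Membership.Propositional.Properties using (∈-++⁺ˡ; ∈-++⁺ʳ)
open import Data.List.Relation.Unary.Any using (here; there)
open import Data.List.Relation.Unary.All as All using (All; []; _∷_)
open import Data.List.Relation.Binary.Subset.Propositional using (_⊆_)
open import Data.Product as Prod using (_×_; _,_; ∃-syntax; proj₁; proj₂)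
open import Data.Sum as Sum using (_⊎_; inj₁; inj₂; [_,_]′)
open import Data.Empty using (⊥-elim)
open import Data.Unit using (⊤)
open import Relation.Binary.PropositionalEquality
open import Function.Bundles using (_⇔_; Equivalence)
open import Induction.WellFounded using (Acc; acc; WellFounded)
import Relation.Binary.Construct.On as On

partition-⊎ : {A : Set} {P Q : A → Set} (xs : List A) →
              (∀ {x} → x ∈ xs → P x ⊎ Q x) →
              ∃[ ys ] All Q ys × (∀ {x} → x ∈ xs → P x ⊎ x ∈ ys)
partition-⊎ [] f = [] , [] , λ ()
partition-⊎ (x ∷ xs) f with partition-⊎ xs (λ x∈ → f (there x∈)) | f (here refl)
... | ys , qs , g | inj₁ px =
  ys , qs , λ { (here refl) → inj₁ px ; (there x∈) → g x∈ }
... | ys , qs , g | inj₂ qx =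
  x ∷ ys , qx ∷ qs ,
  λ { (here refl) → inj₂ (here refl) ; (there x∈) → Sum.map₂ there (g x∈) }

module ReplaceBySmaller {A : Set} (_≺_ : A → A → Set) where

  _◁_ : List A → List A → Set
  N ◁ M = ∃[ ψ ] ψ ∈ M × (∀ {x} → x ∈ N → (x ∈ M × x ≢ ψ) ⊎ x ≺ ψ)

  Acc-◁-⊆ : ∀ {M N} → N ⊆ M → Acc _◁_ M → Acc _◁_ N
  Acc-◁-⊆ N⊆M (acc rs) = acc λ (ψ , ψ∈N , h) →
    rs (ψ , N⊆M ψ∈N , λ x∈ → Sum.map₁ (Prod.map₁ N⊆M) (h x∈))

  Acc-◁-++ : ∀ {a K M} → (∀ {y} → y ≺ a → ∀ {L} → Acc _◁_ L → Acc _◁_ (y ∷ L)) →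
             All (_≺ a) K → Acc _◁_ M → Acc _◁_ (K ++ M)
  Acc-◁-++ add [] accM = accM
  Acc-◁-++ add (y≺a ∷ K≺a) accM = add y≺a (Acc-◁-++ add K≺a accM)

  Acc-◁-∷ : ∀ {a} → Acc _≺_ a → ∀ {M} → Acc _◁_ M → Acc _◁_ (a ∷ M)
  Acc-◁-∷ {a} (acc smaller) = cons
    where
    removeHead : ∀ {M x} → (x ∈ a ∷ M × x ≢ a) ⊎ x ≺ a → x ∈ M ⊎ x ≺ a
    removeHead (inj₁ (here x≡a , x≢a)) = ⊥-elim (x≢a x≡a)
    removeHead (inj₁ (there x∈M , _))  = inj₁ x∈M
    removeHead (inj₂ x≺a)              = inj₂ x≺a

    splitHead : ∀ {M x ψ} → (x ∈ a ∷ M × x ≢ ψ) ⊎ x ≺ ψ →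
                x ≡ a ⊎ ((x ∈ M × x ≢ ψ) ⊎ x ≺ ψ)
    splitHead (inj₁ (here x≡a , _))    = inj₁ x≡a
    splitHead (inj₁ (there x∈M , x≢ψ)) = inj₂ (inj₁ (x∈M , x≢ψ))
    splitHead (inj₂ x≺ψ)               = inj₂ (inj₂ x≺ψ)

    cons : ∀ {M} → Acc _◁_ M → Acc _◁_ (a ∷ M)
    cons {M} (acc reduced) = acc λ where
      (_ , here refl , h) →
        let K , K≺a , N⊆M∪K = partition-⊎ _ (λ x∈ → removeHead (h x∈))
        in Acc-◁-⊆ (λ x∈ → [ ∈-++⁺ʳ K , ∈-++⁺ˡ ]′ (N⊆M∪K x∈))
                   (Acc-◁-++ (λ y≺a → Acc-◁-∷ (smaller y≺a)) K≺a (acc reduced))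
      (ψ , there ψ∈M , h) →
        let L , L-fits , N⊆a∷L = partition-⊎ _ (λ x∈ → splitHead (h x∈))
        in Acc-◁-⊆ (λ x∈ → [ (λ { refl → here refl }) , there ]′ (N⊆a∷L x∈))
                   (cons (reduced (ψ , ψ∈M , All.lookup L-fits)))

  ◁-wellFounded : WellFounded _≺_ → WellFounded _◁_
  ◁-wellFounded wf []      = acc λ { (_ , () , _) }
  ◁-wellFounded wf (a ∷ M) = Acc-◁-∷ (wf a) (◁-wellFounded wf M)

m<1+m+n : ∀ m n → m < suc (m + n)
m<1+m+n m n = s≤s (m≤m+n m n)

n<1+m+n : ∀ m n → n < suc (m + n)
n<1+m+n m n = s≤s (m≤n+m n m)

module _ {Atom : Set} where

  size : Fml Atom → ℕ
  size (term _)        = 1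
  size (φ ∧ ψ)         = suc (size φ + size ψ)
  size (φ ∨ ψ)         = suc (size φ + size ψ)
  size (tmp _ _ _ φ ψ) = suc (suc (size φ + size ψ))

  -- Marking an operator makes it smaller, so that the second child of an
  -- sU/sR expansion is a decrease as well.
  lsize : LFml Atom → ℕ
  lsize (term _)                 = 1
  lsize (φ ∧ ψ)                  = suc (lsize φ + lsize ψ)
  lsize (φ ∨ ψ)                  = suc (lsize φ + lsize ψ)
  lsize (tmp false _ _ _ _ φ ψ)  = suc (suc (size φ + size ψ))
  lsize (tmp true  _ _ _ _ φ ψ)  = suc (size φ + size ψ)

  lsize-expn : ∀ I t φ → lsize (expn I t φ) ≡ size φ
  lsize-expn I t (term _)        = refl
  lsize-expn I t (φ ∧ ψ)         =
    cong₂ (λ m n → suc (m + n)) (lsize-expn I t φ) (lsize-expn I t ψ)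
  lsize-expn I t (φ ∨ ψ)         =
    cong₂ (λ m n → suc (m + n)) (lsize-expn I t φ) (lsize-expn I t ψ)
  lsize-expn I t (tmp _ _ _ _ _) = refl

  lsize-expn-< : ∀ {I t n} φ → size φ < n → lsize (expn I t φ) < n
  lsize-expn-< {I} {t} {n} φ = subst (_< n) (sym (lsize-expn I t φ))

  maxBound : Fml Atom → ℕ
  maxBound (term _)        = 0
  maxBound (φ ∧ ψ)         = maxBound φ ⊔ maxBound ψ
  maxBound (φ ∨ ψ)         = maxBound φ ⊔ maxBound ψ
  maxBound (tmp _ a b φ ψ) = (a ⊔ b) ⊔ (maxBound φ ⊔ maxBound ψ)

  depth : Fml Atom → ℕ
  depth (term _)        = 0
  depth (φ ∧ ψ)         = depth φ ⊔ depth ψ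
  depth (φ ∨ ψ)         = depth φ ⊔ depth ψ
  depth (tmp _ _ _ φ ψ) = suc (depth φ ⊔ depth ψ)

  maxBound-pcl : ∀ ψ {χ} → χ ∈ pcl ψ → maxBound χ ≤ maxBound ψ
  maxBound-pcl (term tt)            (here refl)         = z≤n
  maxBound-pcl (term ff)            (here refl)         = z≤n
  maxBound-pcl (term (lit (pos _))) (here refl)         = z≤n
  maxBound-pcl (term (lit (neg _))) (here refl)         = z≤n
  maxBound-pcl (φ ∧ ψ)              (here refl)         = m≤m⊔n (maxBound φ) (maxBound ψ)
  maxBound-pcl (φ ∧ ψ)              (there (here refl)) = m≤n⊔m (maxBound φ) (maxBound ψ)
  maxBound-pcl (φ ∨ ψ)              (here refl)         = m≤m⊔n (maxBound φ) (maxBound ψ)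
  maxBound-pcl (φ ∨ ψ)              (there (here refl)) = m≤n⊔m (maxBound φ) (maxBound ψ)
  maxBound-pcl (tmp _ _ _ _ _)      (here refl)         = ≤-refl

  maxBound-stepArg : ∀ B ψ₁ ψ₂ → maxBound (stepArg B ψ₁ ψ₂) ≤ maxBound ψ₁ ⊔ maxBound ψ₂
  maxBound-stepArg sU ψ₁ ψ₂ = m≤m⊔n (maxBound ψ₁) (maxBound ψ₂)
  maxBound-stepArg sR ψ₁ ψ₂ = m≤n⊔m (maxBound ψ₁) (maxBound ψ₂)

  upper≤maxBound : ∀ B a b (φ ψ : Fml Atom) → b ≤ maxBound (tmp B a b φ ψ)
  upper≤maxBound B a b φ ψ = ≤-trans (m≤n⊔m a b) (m≤m⊔n (a ⊔ b) _)

-- For the initial superscript [-1,-1] this is 1, which only weakens the bounds below.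
upperᴶ : SInt → ℕ
upperᴶ (_ , u) = ℤ.∣ u ∣

∈ᴶ⇒≤upperᴶ : ∀ {t} J → t ∈ᴶ J → t ≤ upperᴶ J
∈ᴶ⇒≤upperᴶ (_ , + _) (_ , ℤ.+≤+ t≤u) = t≤u

module Bounds {Atom : Set} (Unsat : (Lit Atom → Set) → Set) (G H : ℕ) where

  open ReplaceBySmaller (λ (x y : LFml Atom) → lsize x < lsize y)
  open ≤-Reasoning

  -- G bounds the interval endpoints of the root formula, E bounds how far an
  -- interval reaches beyond the upper end of its superscript, H bounds those
  -- upper ends, and T bounds the time.
  E : ℕ
  E = G + G

  T : ℕ
  T = suc (H + E + G)

  record Endpoint (t : ℕ) (J : SInt) (n : ℕ) : Set where
    constructor endpoint
    field
      near-now         : n ≤ t + G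
      near-superscript : n ≤ upperᴶ J + E

  record BoundedOp (t : ℕ) (J : SInt) (a b : ℕ) (ψ₁ ψ₂ : Fml Atom) : Set where
    constructor boundedOp
    field
      args      : maxBound ψ₁ ⊔ maxBound ψ₂ ≤ G
      lower-end : Endpoint t J a
      upper-end : Endpoint t J b
      nesting   : upperᴶ J + E * suc (depth ψ₁ ⊔ depth ψ₂) ≤ H

    upperᴶ≤H : upperᴶ J ≤ H
    upperᴶ≤H = ≤-trans (m≤m+n (upperᴶ J) _) nesting

  open Endpoint
  open BoundedOp

  Bounded : ℕ → LFml Atom → Set
  Bounded t (term _)              = ⊤
  Bounded t (φ ∧ ψ)               = Bounded t φ × Bounded t ψ
  Bounded t (φ ∨ ψ)               = Bounded t φ × Bounded t ψ
  Bounded t (tmp _ _ J a b ψ₁ ψ₂) = BoundedOp t J a b ψ₁ ψ₂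

  Invariant : List (LFml Atom) → ℕ → Set
  Invariant Γ t = ∀ {x} → x ∈ Γ → Bounded t x

  Endpoint-new : ∀ {t I n} → n ≤ G → t + G ≤ upperᴶ I + E → Endpoint t I (t + n)
  Endpoint-new {t} n≤G t+G≤I+E = endpoint t+n≤t+G (≤-trans t+n≤t+G t+G≤I+E)
    where
    t+n≤t+G = +-monoʳ-≤ t n≤G

  Endpoint-later : ∀ {t t' J n} → t ≤ t' → Endpoint t J n → Endpoint t' J n
  Endpoint-later t≤t' (endpoint n≤t+G n≤J+E) =
    endpoint (≤-trans n≤t+G (+-monoˡ-≤ G t≤t')) n≤J+E

  Endpoint-shift : ∀ {t t' J n} → t ≤ t' → t' ≤ t + G → t ≤ upperᴶ J →
                   Endpoint t J n → Endpoint t' J (n + (t' ∸ t))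
  Endpoint-shift {t} {t'} {J} {n} t≤t' t'≤t+G t≤J (endpoint n≤t+G _) =
    endpoint shifted≤t'+G shifted≤J+E
    where
    shifted≤t'+G : n + (t' ∸ t) ≤ t' + G
    shifted≤t'+G = begin
      n + (t' ∸ t)     ≤⟨ +-monoˡ-≤ (t' ∸ t) n≤t+G ⟩
      t + G + (t' ∸ t) ≡⟨ xy∙z≈xz∙y t G (t' ∸ t) ⟩
      t + (t' ∸ t) + G ≡⟨ cong (_+ G) (m+[n∸m]≡n t≤t') ⟩
      t' + G           ∎
    shifted≤J+E : n + (t' ∸ t) ≤ upperᴶ J + E
    shifted≤J+E = begin
      n + (t' ∸ t) ≤⟨ shifted≤t'+G ⟩
      t' + G       ≤⟨ +-monoˡ-≤ G t'≤t+G ⟩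
      t + G + G    ≡⟨ +-assoc t G G ⟩
      t + E        ≤⟨ +-monoˡ-≤ E t≤J ⟩
      upperᴶ J + E ∎

  Endpoint-≤ : ∀ {t J n} → upperᴶ J ≤ H → Endpoint t J n → n ≤ H + E
  Endpoint-≤ J≤H (endpoint _ n≤J+E) = ≤-trans n≤J+E (+-monoˡ-≤ E J≤H)

  BoundedOp-later : ∀ {t t' J a b ψ₁ ψ₂} → t ≤ t' →
                    BoundedOp t J a b ψ₁ ψ₂ → BoundedOp t' J a b ψ₁ ψ₂
  BoundedOp-later t≤t' (boundedOp args lo up nesting) =
    boundedOp args (Endpoint-later t≤t' lo) (Endpoint-later t≤t' up) nesting

  BoundedOp-shift : ∀ {t t' J a b ψ₁ ψ₂} → t ≤ t' → t' ≤ t + G → t ≤ upperᴶ J →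
                    BoundedOp t J a b ψ₁ ψ₂ →
                    BoundedOp t' J (a + (t' ∸ t)) (b + (t' ∸ t)) ψ₁ ψ₂
  BoundedOp-shift t≤t' t'≤t+G t≤J (boundedOp args lo up nesting) =
    boundedOp args (Endpoint-shift t≤t' t'≤t+G t≤J lo)
                   (Endpoint-shift t≤t' t'≤t+G t≤J up) nesting

  nesting-mono : ∀ {j d d'} → d ≤ d' → j + E * d' ≤ H → j + E * d ≤ H
  nesting-mono {j} d≤d' = ≤-trans (+-monoʳ-≤ j (*-monoʳ-≤ E d≤d'))

  expn-Bounded : ∀ I t ψ → maxBound ψ ≤ G → t + G ≤ upperᴶ I + E →
                 upperᴶ I + E * depth ψ ≤ H → Bounded t (expn I t ψ)
  expn-Bounded I t (term _) _ _ _ = _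
  expn-Bounded I t (φ ∧ ψ) mb t+G≤I+E nest =
    expn-Bounded I t φ (m⊔n≤o⇒m≤o _ _ mb) t+G≤I+E (nesting-mono (m≤m⊔n _ _) nest) ,
    expn-Bounded I t ψ (m⊔n≤o⇒n≤o _ _ mb) t+G≤I+E (nesting-mono (m≤n⊔m _ _) nest)
  expn-Bounded I t (φ ∨ ψ) mb t+G≤I+E nest =
    expn-Bounded I t φ (m⊔n≤o⇒m≤o _ _ mb) t+G≤I+E (nesting-mono (m≤m⊔n _ _) nest) ,
    expn-Bounded I t ψ (m⊔n≤o⇒n≤o _ _ mb) t+G≤I+E (nesting-mono (m≤n⊔m _ _) nest)
  expn-Bounded I t (tmp _ a b φ ψ) mb t+G≤I+E nest =
    boundedOp (m⊔n≤o⇒n≤o (a ⊔ b) _ mb)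
              (Endpoint-new (m⊔n≤o⇒m≤o a b a⊔b≤G) t+G≤I+E)
              (Endpoint-new (m⊔n≤o⇒n≤o a b a⊔b≤G) t+G≤I+E) nest
    where
    a⊔b≤G = m⊔n≤o⇒m≤o (a ⊔ b) _ mb

  -- The new superscript is [a,b], and b lies at most E above the old one while
  -- the nesting depth drops by one.
  expn-arg-Bounded : ∀ {t J a b ψ₁ ψ₂} χ → BoundedOp t J a b ψ₁ ψ₂ → t ≤ b →
                     maxBound χ ≤ maxBound ψ₁ ⊔ maxBound ψ₂ →
                     depth χ ≤ depth ψ₁ ⊔ depth ψ₂ → Bounded t (expn (ι a b) t χ)
  expn-arg-Bounded {t} {J} {a} {b} {ψ₁} {ψ₂} χ op t≤b mbχ dχ =
    expn-Bounded (ι a b) t χ (≤-trans mbχ (args op)) (+-mono-≤ t≤b (m≤m+n G G)) nest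
    where
    d = depth ψ₁ ⊔ depth ψ₂
    nest : b + E * depth χ ≤ H
    nest = begin
      b + E * depth χ        ≤⟨ +-mono-≤ (near-superscript (upper-end op)) (*-monoʳ-≤ E dχ) ⟩
      upperᴶ J + E + E * d   ≡⟨ +-assoc (upperᴶ J) E (E * d) ⟩
      upperᴶ J + (E + E * d) ≡⟨ cong (λ e → upperᴶ J + e) (sym (*-suc E d)) ⟩
      upperᴶ J + E * suc d   ≤⟨ nesting op ⟩
      H                      ∎

  Invariant-replace : ∀ {Γ ψ Δ Γ' t} → Replace Γ ψ Δ Γ' → Invariant Γ t →
                      All (Bounded t) Δ → Invariant Γ' t
  Invariant-replace r inv newBounded {x} x∈Γ' =
    [ (λ (x∈Γ , _) → inv x∈Γ) , All.lookup newBounded ]′ (Equivalence.to (r x) x∈Γ')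

  Invariant-expand : ∀ {Γ Γ' t} → ExpandChild Γ t Γ' → Invariant Γ t → Invariant Γ' t
  Invariant-expand (∨₁ mem r) inv = Invariant-replace r inv (proj₁ (inv mem) ∷ [])
  Invariant-expand (∨₂ mem r) inv = Invariant-replace r inv (proj₂ (inv mem) ∷ [])
  Invariant-expand (∧₁ mem r) inv =
    Invariant-replace r inv (proj₁ (inv mem) ∷ proj₂ (inv mem) ∷ [])
  Invariant-expand (sU₁ {ψ₂ = ψ₂} mem _ t≤b r) inv = Invariant-replace r inv
    (expn-arg-Bounded ψ₂ (inv mem) t≤b (m≤n⊔m _ _) (m≤n⊔m _ _) ∷ [])
  Invariant-expand (sU₂ {ψ₁ = ψ₁} mem _ t≤b r) inv = Invariant-replace r inv
    (expn-arg-Bounded ψ₁ (inv mem) t≤b (m≤m⊔n _ _) (m≤m⊔n _ _) ∷ inv mem ∷ [])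
  Invariant-expand (sR₁ {ψ₁ = ψ₁} {ψ₂} mem _ t≤b r) inv = Invariant-replace r inv
    (expn-arg-Bounded (ψ₁ ∧ ψ₂) (inv mem) t≤b ≤-refl ≤-refl ∷ [])
  Invariant-expand (sR₂ {ψ₂ = ψ₂} mem _ t≤b r) inv = Invariant-replace r inv
    (expn-arg-Bounded ψ₂ (inv mem) t≤b (m≤n⊔m _ _) (m≤n⊔m _ _) ∷ inv mem ∷ [])

  ◁-replace : ∀ {Γ ψ Δ Γ'} → Replace Γ ψ Δ Γ' → ψ ∈ Γ →
              All (λ x → lsize x < lsize ψ) Δ → Γ' ◁ Γ
  ◁-replace {ψ = ψ} r ψ∈Γ smaller =
    ψ , ψ∈Γ , λ {x} x∈Γ' → Sum.map₂ (All.lookup smaller) (Equivalence.to (r x) x∈Γ')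

  expand-◁ : ∀ {Γ Γ' t} → ExpandChild Γ t Γ' → Γ' ◁ Γ
  expand-◁ (∨₁ {φ} {ψ} mem r) = ◁-replace r mem (m<1+m+n (lsize φ) (lsize ψ) ∷ [])
  expand-◁ (∨₂ {φ} {ψ} mem r) = ◁-replace r mem (n<1+m+n (lsize φ) (lsize ψ) ∷ [])
  expand-◁ (∧₁ {φ} {ψ} mem r) =
    ◁-replace r mem (m<1+m+n (lsize φ) (lsize ψ) ∷ n<1+m+n (lsize φ) (lsize ψ) ∷ [])
  expand-◁ (sU₁ {ψ₁ = ψ₁} {ψ₂} mem _ _ r) =
    ◁-replace r mem (lsize-expn-< ψ₂ (m<n⇒m<1+n (n<1+m+n (size ψ₁) (size ψ₂))) ∷ [])
  expand-◁ (sU₂ {ψ₁ = ψ₁} {ψ₂} mem _ _ r) =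
    ◁-replace r mem
      (lsize-expn-< ψ₁ (m<n⇒m<1+n (m<1+m+n (size ψ₁) (size ψ₂))) ∷ n<1+n _ ∷ [])
  expand-◁ (sR₁ {ψ₁ = ψ₁} {ψ₂} mem _ _ r) =
    ◁-replace r mem (lsize-expn-< (ψ₁ ∧ ψ₂) (n<1+n _) ∷ [])
  expand-◁ (sR₂ {ψ₁ = ψ₁} {ψ₂} mem _ _ r) =
    ◁-replace r mem
      (lsize-expn-< ψ₂ (m<n⇒m<1+n (n<1+m+n (size ψ₁) (size ψ₂))) ∷ n<1+n _ ∷ [])

  H+E<T : H + E < T
  H+E<T = s≤s (m≤m+n (H + E) G)

  step-time< : ∀ {Γ t} → StepCond Γ t → Invariant Γ t → t < T
  step-time< (atEnd mem _ refl) inv =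
    ≤-<-trans (Endpoint-≤ (upperᴶ≤H (inv mem)) (upper-end (inv mem))) H+E<T
  step-time< (inner {B} {ψ₁ = ψ₁} {ψ₂} {B'} {a'} {b'} {χ₁} {χ₂} mem _ χ∈pcl t<a+b') inv =
    <-≤-trans t<a+b' (≤-trans (+-mono-≤ a≤H+E b'≤G) (n≤1+n _))
    where
    op = inv mem
    a≤H+E = Endpoint-≤ (upperᴶ≤H op) (lower-end op)
    b'≤G : b' ≤ G
    b'≤G = begin
      b'                            ≤⟨ upper≤maxBound B' a' b' χ₁ χ₂ ⟩
      maxBound (tmp B' a' b' χ₁ χ₂) ≤⟨ maxBound-pcl (stepArg B ψ₁ ψ₂) χ∈pcl ⟩
      maxBound (stepArg B ψ₁ ψ₂)    ≤⟨ maxBound-stepArg B ψ₁ ψ₂ ⟩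
      maxBound ψ₁ ⊔ maxBound ψ₂     ≤⟨ args op ⟩
      G                             ∎

  Invariant-step : ∀ {Γ Γ' t} → (∀ x → (x ∈ Γ') ⇔ StepMem Γ t x) →
                   Invariant Γ t → Invariant Γ' (suc t)
  Invariant-step mem inv {x} x∈Γ' with Equivalence.to (mem x) x∈Γ'
  ... | keep m     = BoundedOp-later (n≤1+n _) (inv m)
  ... | unmark m _ = BoundedOp-later (n≤1+n _) (inv m)

  Endpoint-bounds : ∀ {t J a b ψ₁ ψ₂ n} → BoundedOp t J a b ψ₁ ψ₂ → Endpoint t J n →
                    n ≤ t + G × n < T
  Endpoint-bounds op e = near-now e , ≤-<-trans (Endpoint-≤ (upperᴶ≤H op) e) H+E<T

  InK-bounds : ∀ {Γ t s} → InK Γ t s → Invariant Γ t → s ≤ t + G × s < T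
  InK-bounds (lower mem _ refl) inv = Endpoint-bounds (inv mem) (lower-end (inv mem))
  InK-bounds (upper mem _ refl) inv = Endpoint-bounds (inv mem) (upper-end (inv mem))

  Invariant-jump : ∀ {Γ Γ' t t'} → t < t' → t' ≤ t + G →
                   (∀ x → (x ∈ Γ') ⇔ JumpMem Γ t (t' ∸ t) x) →
                   Invariant Γ t → Invariant Γ' t'
  Invariant-jump t<t' t'≤t+G mem inv {x} x∈Γ' with Equivalence.to (mem x) x∈Γ'
  ... | keep m _                    = BoundedOp-later (<⇒≤ t<t') (inv m)
  ... | unmark m _ _                = BoundedOp-later (<⇒≤ t<t') (inv m)
  ... | shift {J = J} m t∈J         =
    BoundedOp-shift (<⇒≤ t<t') t'≤t+G (∈ᴶ⇒≤upperᴶ J t∈J) (inv m)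
  ... | unmarkShift {J = J} m t∈J _ =
    BoundedOp-shift (<⇒≤ t<t') t'≤t+G (∈ᴶ⇒≤upperᴶ J t∈J) (inv m)

  ◁-wf : WellFounded _◁_
  ◁-wf = ◁-wellFounded (On.wellFounded lsize <-wellFounded)

  finite-acc : ∀ t → Acc _<_ (T ∸ t) → ∀ Γ → Acc _◁_ Γ → Invariant Γ t →
               FiniteTableau Unsat (Γ , t)
  finite-acc t (acc later) = expansions
    where
    expansions : ∀ Γ → Acc _◁_ Γ → Invariant Γ t → FiniteTableau Unsat (Γ , t)
    expansions Γ (acc smaller) inv = acc λ where
      (expand e) → expansions _ (smaller (expand-◁ e)) (Invariant-expand e inv)
      (step _ _ _ sc mem) →
        finite-acc (suc t) (later (∸-monoʳ-< (n<1+n t) (step-time< sc inv))) _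
                   (◁-wf _) (Invariant-step mem inv)
      (jump _ _ _ _ (t'∈K , t<t' , _) mem) →
        let t'≤t+G , t'<T = InK-bounds t'∈K inv
        in finite-acc _ (later (∸-monoʳ-< t<t' (<⇒≤ t'<T))) _
                      (◁-wf _) (Invariant-jump t<t' t'≤t+G mem inv)

  finite : ∀ t Γ → Invariant Γ t → FiniteTableau Unsat (Γ , t)
  finite t Γ = finite-acc t (<-wellFounded _) Γ (◁-wf Γ)

theorem4p2 : (Atom : Set) (Unsat : (Lit Atom → Set) → Set)
             (φ : Fml Atom) → WF φ → FiniteTableau Unsat (root φ)
theorem4p2 Atom Unsat φ _ = finite 0 (expn minus1 0 φ ∷ []) root-Invariant
  where
  G H : ℕ
  G = maxBound φ
  H = suc ((G + G) * depth φ)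

  open Bounds Unsat G H

  root-Invariant : Invariant (expn minus1 0 φ ∷ []) 0
  root-Invariant (here refl) =
    expn-Bounded minus1 0 φ ≤-refl (≤-trans (m≤m+n G G) (n≤1+n _)) ≤-refl
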